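{- Let $\mathbf A$ be an $\mathbf{I}_{2,0}$-chain with $|A|\ge 2$ and let $a,b\in A$. If $0\sqsubseteq a$ and $b\sqsubset 0$, then $b\to a=b$ and $a\to b=b$.
   Context: A zroupoid is an algebra $\langle A,\to,0\rangle$ with binary $\to$ and constant $0$; $x':=x\to 0$. An implication zroupoid satisfies (I) $(x\to y)\to z\approx[(z'\to x)\to(y\to z)']'$ and $0''\approx 0$; $\mathbf{I}_{2,0}$ is the variety of implication zroupoids satisfying $x''\approx x$. For $x,y\in A$, $x\sqsubseteq y$ iff $(x\to y')'=x$; $x\sqsubset y$ means $x\sqsubseteq y$ and $x\ne y$. An $\mathbf{I}_{2,0}$-chain is a member of $\mathbf{I}_{2,0}$ on which $\sqsubseteq$ is a total order. -}

module Defs where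

open import Level using (Level; suc)
open import Relation.Binary.PropositionalEquality using (_≡_; _≢_)
open import Data.Product using (Σ; ∃; _×_)
open import Data.Sum using (_⊎_)

record Zroupoid (ℓ : Level) : Set (suc ℓ) where
  field
    Carrier : Set ℓ
    _⇒_     : Carrier → Carrier → Carrier
    𝟘       : Carrier
  infixr 5 _⇒_

  _′ : Carrier → Carrier
  x ′ = x ⇒ 𝟘
  infix 8 _′

  _⊑_ : Carrier → Carrier → Set ℓ
  x ⊑ y = ((x ⇒ (y ′)) ′) ≡ x

  _⊏_ : Carrier → Carrier → Set ℓ
  x ⊏ y = (x ⊑ y) × (x ≢ y)

module _ {ℓ : Level} (A : Zroupoid ℓ) where
  open Zroupoid A

  IsImplicationZroupoid : Set ℓ
  IsImplicationZroupoid =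
    (∀ x y z → ((x ⇒ y) ⇒ z) ≡ ((((z ′) ⇒ x) ⇒ ((y ⇒ z) ′)) ′))
    × (((𝟘 ′) ′) ≡ 𝟘)

  IsI₂₀ : Set ℓ
  IsI₂₀ = IsImplicationZroupoid × (∀ x → ((x ′) ′) ≡ x)

  IsI₂₀Chain : Set ℓ
  IsI₂₀Chain =
    IsI₂₀
    × (∀ x → x ⊑ x)
    × (∀ x y → x ⊑ y → y ⊑ x → x ≡ y)
    × (∀ x y z → x ⊑ y → y ⊑ z → x ⊑ z)
    × (∀ x y → (x ⊑ y) ⊎ (y ⊑ x))

  AtLeastTwo : Set ℓ
  AtLeastTwo = Σ Carrier λ x → Σ Carrier λ y → x ≢ y

module Submission where

-- The proof has three layers.
--   * Equational facts valid in every algebra of I₂,₀ (identity (I) together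
--     with x'' = x): 0' is a left unit for →, x' = x → (0 → x)',
--     x' → 0' = 0 → x, and a "flip" form of (I) for the meet (x → y')'.
--   * Order facts in I₂,₀ derived from them: 0 ⊑ x implies 0 ⊑ x';
--     b ⊑ a implies (a → b')' = b; and x ⊑ x', x' ⊑ 0 force x' = x.
--   * In a chain, totality and antisymmetry turn these into b' = b for every
--     b ⊏ 0.  Then b ⊑ a' and (a → b')' = b say that (b → a)' = b and
--     (a → b)' = b, and since b' = b, negation being injective gives
--     b → a = b and a → b = b.

open import Defs
open import Level using (Level)
open import Relation.Binary.PropositionalEquality
  using (_≡_; sym; trans; cong; cong₂; subst; module ≡-Reasoning)
open import Data.Product using (_×_; _,_; proj₁; proj₂)
open import Data.Sum using (_⊎_; inj₁; inj₂)
open import Data.Empty using (⊥-elim)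

module I₂₀Algebra {ℓ : Level} (A : Zroupoid ℓ) (isI₂₀ : IsI₂₀ A) where
  open Zroupoid A
  open ≡-Reasoning

  axiom-I : ∀ x y z → (x ⇒ y) ⇒ z ≡ ((z ′ ⇒ x) ⇒ (y ⇒ z) ′) ′
  axiom-I = proj₁ (proj₁ isI₂₀)

  ′-involutive : ∀ x → x ′ ′ ≡ x
  ′-involutive = proj₂ isI₂₀

  ′-transpose : ∀ {u v} → u ′ ≡ v → u ≡ v ′
  ′-transpose {u} p = trans (sym (′-involutive u)) (cong _′ p)

  ′-injective : ∀ {u v} → u ′ ≡ v ′ → u ≡ v
  ′-injective {v = v} p = trans (′-transpose p) (′-involutive v)

  -- 0' is a left unit for →  ((I) with y = z = 0).
  ⇒-identityˡ : ∀ x → 𝟘 ′ ⇒ x ≡ x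
  ⇒-identityˡ x = begin
    𝟘 ′ ⇒ x                        ≡⟨ sym (′-involutive _) ⟩
    ((𝟘 ′ ⇒ x) ⇒ 𝟘) ′              ≡⟨ cong (λ t → ((𝟘 ′ ⇒ x) ⇒ t) ′) (sym (′-involutive 𝟘)) ⟩
    ((𝟘 ′ ⇒ x) ⇒ (𝟘 ⇒ 𝟘) ′) ′      ≡⟨ sym (axiom-I x 𝟘 𝟘) ⟩
    x ′ ′                          ≡⟨ ′-involutive x ⟩
    x                              ∎

  𝟘⇒-expand : ∀ y z → (𝟘 ⇒ y) ⇒ z ≡ (z ⇒ (y ⇒ z) ′) ′
  𝟘⇒-expand y z =
    trans (axiom-I 𝟘 y z) (cong (λ t → (t ⇒ (y ⇒ z) ′) ′) (′-involutive z))

  ′-expand : ∀ x → x ′ ≡ x ⇒ (𝟘 ⇒ x) ′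
  ′-expand x = begin
    x ′                          ≡⟨ cong _′ (sym (⇒-identityˡ x)) ⟩
    (𝟘 ′ ⇒ x) ′                  ≡⟨ cong _′ (𝟘⇒-expand 𝟘 x) ⟩
    (x ⇒ (𝟘 ⇒ x) ′) ′ ′          ≡⟨ ′-involutive _ ⟩
    x ⇒ (𝟘 ⇒ x) ′                ∎

  ⇒𝟘′-collapse : ∀ x y → y ⇒ 𝟘 ′ ≡ 𝟘 ′ → (x ⇒ y) ⇒ 𝟘 ′ ≡ 𝟘 ⇒ x
  ⇒𝟘′-collapse x y y⇒𝟘′ = begin
    (x ⇒ y) ⇒ 𝟘 ′                      ≡⟨ axiom-I x y (𝟘 ′) ⟩
    ((𝟘 ′ ′ ⇒ x) ⇒ (y ⇒ 𝟘 ′) ′) ′      ≡⟨ cong₂ (λ s t → ((s ⇒ x) ⇒ t ′) ′) (′-involutive 𝟘) y⇒𝟘′ ⟩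
    ((𝟘 ⇒ x) ⇒ 𝟘 ′ ′) ′                ≡⟨ cong (λ t → ((𝟘 ⇒ x) ⇒ t) ′) (′-involutive 𝟘) ⟩
    (𝟘 ⇒ x) ′ ′                        ≡⟨ ′-involutive _ ⟩
    𝟘 ⇒ x                              ∎

  ⇒𝟘′-twice : ∀ x → (x ⇒ 𝟘 ′) ⇒ 𝟘 ′ ≡ 𝟘 ⇒ x
  ⇒𝟘′-twice x = ⇒𝟘′-collapse x (𝟘 ′) (⇒-identityˡ (𝟘 ′))

  𝟘⇒𝟘′ : 𝟘 ⇒ 𝟘 ′ ≡ 𝟘 ′
  𝟘⇒𝟘′ = begin
    𝟘 ⇒ 𝟘 ′                  ≡⟨ sym (⇒𝟘′-twice (𝟘 ′)) ⟩
    (𝟘 ′ ⇒ 𝟘 ′) ⇒ 𝟘 ′        ≡⟨ cong (_⇒ 𝟘 ′) (⇒-identityˡ (𝟘 ′)) ⟩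
    𝟘 ′ ⇒ 𝟘 ′                ≡⟨ ⇒-identityˡ (𝟘 ′) ⟩
    𝟘 ′                      ∎

  contrapose-𝟘 : ∀ x → x ′ ⇒ 𝟘 ′ ≡ 𝟘 ⇒ x
  contrapose-𝟘 x = ⇒𝟘′-collapse x 𝟘 𝟘⇒𝟘′

  ⇒𝟘′-swap : ∀ x → x ⇒ 𝟘 ′ ≡ 𝟘 ⇒ x ′
  ⇒𝟘′-swap x =
    trans (cong (_⇒ 𝟘 ′) (sym (′-involutive x))) (contrapose-𝟘 (x ′))

  meet-flip : ∀ x y → (x ⇒ y ′) ′ ≡ (y ⇒ x ′) ⇒ (𝟘 ⇒ y ′) ′
  meet-flip x y = begin
    (x ⇒ y ′) ′                            ≡⟨ cong (λ t → (t ⇒ y ′) ′) (sym (′-involutive x)) ⟩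
    (x ′ ′ ⇒ y ′) ′                        ≡⟨ cong _′ (axiom-I (x ′) 𝟘 (y ′)) ⟩
    ((y ′ ′ ⇒ x ′) ⇒ (𝟘 ⇒ y ′) ′) ′ ′      ≡⟨ ′-involutive _ ⟩
    (y ′ ′ ⇒ x ′) ⇒ (𝟘 ⇒ y ′) ′            ≡⟨ cong (λ t → (t ⇒ x ′) ⇒ (𝟘 ⇒ y ′) ′) (′-involutive y) ⟩
    (y ⇒ x ′) ⇒ (𝟘 ⇒ y ′) ′                ∎

  𝟘⊑-′ : ∀ {x} → 𝟘 ⊑ x → 𝟘 ⊑ (x ′)
  𝟘⊑-′ {x} 𝟘⊑x = begin
    (𝟘 ⇒ x ′ ′) ′          ≡⟨ cong (λ t → (𝟘 ⇒ t) ′) (′-involutive x) ⟩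
    (𝟘 ⇒ x) ′              ≡⟨ cong _′ (sym (⇒𝟘′-twice x)) ⟩
    ((x ⇒ 𝟘 ′) ⇒ 𝟘 ′) ′    ≡⟨ cong (λ t → (t ⇒ 𝟘 ′) ′) x⇒𝟘′ ⟩
    (𝟘 ′ ⇒ 𝟘 ′) ′          ≡⟨ cong _′ (⇒-identityˡ (𝟘 ′)) ⟩
    𝟘 ′ ′                  ≡⟨ ′-involutive 𝟘 ⟩
    𝟘                      ∎
    where
    x⇒𝟘′ : x ⇒ 𝟘 ′ ≡ 𝟘 ′
    x⇒𝟘′ = trans (⇒𝟘′-swap x) (′-transpose 𝟘⊑x)

  ⊑-flip : ∀ {x y} → x ⊑ y → (y ⇒ x ′) ′ ≡ x
  ⊑-flip {x} {y} x⊑y = begin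
    (y ⇒ x ′) ′                      ≡⟨ meet-flip y x ⟩
    (x ⇒ y ′) ⇒ (𝟘 ⇒ x ′) ′          ≡⟨ cong (_⇒ (𝟘 ⇒ x ′) ′) (′-transpose x⊑y) ⟩
    x ′ ⇒ (𝟘 ⇒ x ′) ′                ≡⟨ sym (′-expand (x ′)) ⟩
    x ′ ′                            ≡⟨ ′-involutive x ⟩
    x                                ∎

  ′-fixed : ∀ {x} → x ⊑ (x ′) → (x ′) ⊑ 𝟘 → x ′ ≡ x
  ′-fixed {x} x⊑x′ x′⊑𝟘 = begin
    x ′                        ≡⟨ sym x⇒x ⟩
    x ⇒ x                      ≡⟨ cong (_⇒ x) (sym 𝟘⇒x) ⟩
    (𝟘 ⇒ x) ⇒ x                ≡⟨ 𝟘⇒-expand x x ⟩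
    (x ⇒ (x ⇒ x) ′) ′          ≡⟨ cong (λ t → (x ⇒ t ′) ′) x⇒x ⟩
    (x ⇒ x ′ ′) ′              ≡⟨ x⊑x′ ⟩
    x                          ∎
    where
    x⇒x : x ⇒ x ≡ x ′
    x⇒x = ′-transpose (trans (cong (λ t → (x ⇒ t) ′) (sym (′-involutive x))) x⊑x′)

    𝟘⇒x : 𝟘 ⇒ x ≡ x
    𝟘⇒x = ′-injective (trans (cong _′ (sym (contrapose-𝟘 x))) x′⊑𝟘)

  absorbed-by-fixed : ∀ {b u} → b ′ ≡ b → u ′ ≡ b → u ≡ b
  absorbed-by-fixed b′≡b u′≡b = trans (′-transpose u′≡b) b′≡b

module I₂₀Chain {ℓ : Level} (A : Zroupoid ℓ) (isI₂₀ : IsI₂₀ A)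
  (antisym : ∀ x y → Zroupoid._⊑_ A x y → Zroupoid._⊑_ A y x → x ≡ y)
  (total : ∀ x y → Zroupoid._⊑_ A x y ⊎ Zroupoid._⊑_ A y x) where
  open Zroupoid A
  open I₂₀Algebra A isI₂₀

  -- If b ⊏ 0 then b' ⊑ 0: otherwise 0 ⊑ b' gives 0 ⊑ b'' = b, so b = 0.
  negation-below-𝟘 : ∀ {b} → b ⊏ 𝟘 → (b ′) ⊑ 𝟘
  negation-below-𝟘 {b} (b⊑𝟘 , b≢𝟘) with total 𝟘 (b ′)
  ... | inj₁ 𝟘⊑b′ = ⊥-elim (b≢𝟘 (antisym b 𝟘 b⊑𝟘 𝟘⊑b))
    where
    𝟘⊑b : 𝟘 ⊑ b
    𝟘⊑b = subst (𝟘 ⊑_) (′-involutive b) (𝟘⊑-′ 𝟘⊑b′)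
  ... | inj₂ b′⊑𝟘 = b′⊑𝟘

  -- Every element strictly below 0 is a fixed point of negation: compare b
  -- with b' and apply ′-fixed to b or to b' (using b'' = b).
  negative-fixed : ∀ {b} → b ⊏ 𝟘 → b ′ ≡ b
  negative-fixed {b} b⊏𝟘@(b⊑𝟘 , _) with total b (b ′)
  ... | inj₁ b⊑b′ = ′-fixed b⊑b′ (negation-below-𝟘 b⊏𝟘)
  ... | inj₂ b′⊑b = trans (sym (′-fixed b′⊑b′′ b′′⊑𝟘)) (′-involutive b)
    where
    b′⊑b′′ : (b ′) ⊑ (b ′ ′)
    b′⊑b′′ = subst ((b ′) ⊑_) (sym (′-involutive b)) b′⊑b

    b′′⊑𝟘 : (b ′ ′) ⊑ 𝟘
    b′′⊑𝟘 = subst (_⊑ 𝟘) (sym (′-involutive b)) b⊑𝟘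

-- Since b ⊑ 0 ⊑ a and 0 ⊑ a', transitivity gives b ⊑ a'  (i.e. (b → a)' = b)
-- and b ⊑ a, whose flip is (a → b')' = b, i.e. (a → b)' = b as b' = b.
lemma5p8 : {ℓ : Level} (A : Zroupoid ℓ) → IsI₂₀Chain A → AtLeastTwo A →
    (a b : Zroupoid.Carrier A) →
    Zroupoid._⊑_ A (Zroupoid.𝟘 A) a → Zroupoid._⊏_ A b (Zroupoid.𝟘 A) →
    (Zroupoid._⇒_ A b a ≡ b) × (Zroupoid._⇒_ A a b ≡ b)
lemma5p8 A (isI₂₀ , _ , antisym , ⊑-trans , total) _ a b 𝟘⊑a b⊏𝟘@(b⊑𝟘 , _) =
  absorbed-by-fixed b′≡b [b⇒a]′≡b , absorbed-by-fixed b′≡b [a⇒b]′≡b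
  where
  open Zroupoid A
  open I₂₀Algebra A isI₂₀
  open I₂₀Chain A isI₂₀ antisym total

  b′≡b : b ′ ≡ b
  b′≡b = negative-fixed b⊏𝟘

  b⊑a : b ⊑ a
  b⊑a = ⊑-trans b 𝟘 a b⊑𝟘 𝟘⊑a

  b⊑a′ : b ⊑ (a ′)
  b⊑a′ = ⊑-trans b 𝟘 (a ′) b⊑𝟘 (𝟘⊑-′ 𝟘⊑a)

  [b⇒a]′≡b : (b ⇒ a) ′ ≡ b
  [b⇒a]′≡b = trans (cong (λ t → (b ⇒ t) ′) (sym (′-involutive a))) b⊑a′

  [a⇒b]′≡b : (a ⇒ b) ′ ≡ b
  [a⇒b]′≡b = trans (cong (λ t → (a ⇒ t) ′) (sym b′≡b)) (⊑-flip b⊑a)
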